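{- Let $G=([\ell],\mathcal{E})$ be a simple graph with chromatic polynomial $c_G(t)$. Define $W_G(t)$ and $Y_G(t)=\sum_{k=1}^\ell y_k(G)t^k$ by $\sum_{q\ge0}c_G(q)t^q=\frac{W_G(t)}{(1-t)^{\ell+1}}$ and $\sum_{q\ge1}\frac{c_G(q)}{q}t^q=\frac{Y_G(t)}{(1-t)^\ell}$, and write $W_G(t)=\sum_k w_k(G)t^k$. Then $$W_G(t)=t(1-t)\frac{d}{dt}Y_G(t)+t\ell Y_G(t),$$ equivalently $w_k(G)=k\,y_k(G)+(\ell-k+1)y_{k-1}(G)$ for every $1\le k\le\ell$ (with $y_0(G)=0$). Conversely, if $F(t)$ is a polynomial with $F(0)=0$ such that $W_G(t)=t(1-t)\frac{d}{dt}F(t)+t\ell F(t)$, then $F(t)=Y_G(t)$.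
   Context: $c_G(q)$ is the number of proper colorings of $G$ with $q$ colors; it is a polynomial in $q$ divisible by $q$. -}

module Defs where

open import Data.Bool using (Bool; true; false; not; _∧_)
open import Data.Nat as ℕ using (ℕ; zero; suc; NonZero)
open import Data.Nat.DivMod using (_/_)
open import Data.Nat.Combinatorics using (_C_)
open import Data.Fin using (Fin; _≟_)
open import Data.List using (List; []; _∷_; map; concatMap; filter; length; allFin)
open import Data.Bool.ListAction using (all)
open import Data.Vec.Functional using () renaming (_∷_ to _∷ᶠ_)
open import Data.Integer as ℤ using (ℤ; +_; -_)
open import Relation.Nullary.Decidable using (⌊_⌋)
open import Relation.Binary.PropositionalEquality using (_≡_; _≢_)

record SimpleGraph (ℓ : ℕ) : Set where
  field
    adj     : Fin ℓ → Fin ℓ → Bool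
    sym     : ∀ i j → adj i j ≡ adj j i
    irrefl  : ∀ i → adj i i ≡ false
open SimpleGraph public

allMaps : (ℓ q : ℕ) → List (Fin ℓ → Fin q)
allMaps zero    q = (λ ()) ∷ []
allMaps (suc ℓ) q = concatMap (λ c → map (λ f → c ∷ᶠ f) (allMaps ℓ q)) (allFin q)

isProper : ∀ {ℓ q} → SimpleGraph ℓ → (Fin ℓ → Fin q) → Bool
isProper {ℓ} G col =
  all (λ i → all (λ j → not (adj G i j ∧ ⌊ col i ≟ col j ⌋)) (allFin ℓ)) (allFin ℓ)

chromatic : ∀ {ℓ} → SimpleGraph ℓ → ℕ → ℕ
chromatic {ℓ} G q = length (filter (λ col → isProper G col ≡? true) (allMaps ℓ q))
  where
  open import Data.Bool using () renaming (_≟_ to _≡?_)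

-- c_G(q)/q for q ≥ 1 (exact division, since q ∣ c_G(q) for ℓ ≥ 1);
-- the q = 0 term is absent from the series, i.e. coefficient 0.
chromaticOverQ : ∀ {ℓ} → SimpleGraph ℓ → ℕ → ℕ
chromaticOverQ G zero    = 0
chromaticOverQ G (suc q) = chromatic G (suc q) / suc q

sumBelow : (ℕ → ℤ) → ℕ → ℤ
sumBelow f zero    = + 0
sumBelow f (suc n) = sumBelow f n ℤ.+ f n

sgn : ℕ → ℤ
sgn zero    = + 1
sgn (suc j) = - sgn j

-- Coefficient of t^k in the formal power series (1-t)^m · Σ_{q≥0} a(q) t^q,
-- i.e. Σ_{j=0}^{k} (-1)^j binom(m,j) a(k-j).
timesOneMinusTPow : ℕ → (ℕ → ℕ) → ℕ → ℤ
timesOneMinusTPow m a k = sumBelow (λ j → sgn j ℤ.* (+ (m C j)) ℤ.* (+ a (k ℕ.∸ j))) (suc k)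

w : ∀ {ℓ} → SimpleGraph ℓ → ℕ → ℤ
w {ℓ} G = timesOneMinusTPow (suc ℓ) (chromatic G)

y : ∀ {ℓ} → SimpleGraph ℓ → ℕ → ℤ
y {ℓ} G = timesOneMinusTPow ℓ (chromaticOverQ G)

-- Polynomials with integer coefficients as coefficient lists (constant term first).
Poly : Set
Poly = List ℤ

coeff : Poly → ℕ → ℤ
coeff []       k       = + 0
coeff (a ∷ as) zero    = a
coeff (a ∷ as) (suc k) = coeff as k

-- Coefficient of t^k in t(1-t) F'(t) + t ℓ F(t), for F with coefficients f:
-- k f_k + (ℓ - k + 1) f_{k-1}   (and 0 for k = 0).
diffOpCoeff : ℕ → (ℕ → ℤ) → ℕ → ℤ
diffOpCoeff ℓ f zero    = + 0
diffOpCoeff ℓ f (suc k) =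
  (+ suc k) ℤ.* f (suc k) ℤ.+ ((+ ℓ) ℤ.- (+ k)) ℤ.* f k

module Submission where

-- Everything is done on coefficient sequences ℕ → ℤ.  Multiplication by
-- (1-t) is the difference operator Δ; Pascal's rule shows that
-- timesOneMinusTPow m a is the m-fold difference Δ^ m a.  Writing
-- weighted b for q ↦ q·b(q) (the series t·B'(t)), the two identities
--   Δ (weighted b) = D₀ b      and      Δ (D_m b) = D_{m+1} (Δ b)
-- give Δ^ (m+1) (weighted b) = D_m (Δ^ m b) by induction on m.  A recolouring
-- argument shows c_G(q) = q · (c_G(q)/q) when ℓ ≥ 1, so the case
-- b = c_G(q)/q, m = ℓ is W_G = D_ℓ Y_G.  Uniqueness holds because D_m is
-- injective on sequences with a prescribed constant term.

open import Defs
open import Data.Nat using (ℕ; _≥_)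
open import Data.Integer using (ℤ; +_)
open import Data.Product using (_×_)
open import Relation.Binary.PropositionalEquality using (_≡_)

open import Data.Bool using (Bool; true; false; not; _∧_) renaming (_≟_ to _≡?_)
open import Data.Bool.ListAction using (all)
open import Data.Empty using (⊥-elim)
open import Data.Fin using (Fin; _≟_) renaming (zero to fzero; suc to fsuc)
open import Data.Fin.Permutation using (Permutation′; _⟨$⟩ʳ_; transpose)
open import Function.Properties.Inverse using (↔⇒↣)
open import Data.Integer as ℤ using (_+_; _*_; -_; _-_)
import Data.Integer.Properties as ℤP
open import Data.Integer.Tactic.RingSolver using (solve-∀)
open import Data.List using (List; []; _∷_; map; filter; length; concatMap; tabulate; allFin)
open import Data.List.Properties using (filter-++; length-++; filter-≐)
open import Data.Nat as ℕ using (zero; suc; _∸_)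
import Data.Nat.Properties as ℕP
open import Data.Nat.Combinatorics using (_C_; nCk+nC[k+1]≡[n+1]C[k+1])
open import Data.Nat.DivMod using (_/_; m*n/n≡m)
open import Data.Product using (_,_)
open import Data.Vec.Functional using () renaming (_∷_ to _∷ᶠ_)
open import Function using (_∘_; Injection)
import Relation.Binary.PropositionalEquality as ≡
open import Relation.Binary.PropositionalEquality using (refl; trans; cong; cong₂; module ≡-Reasoning)
open import Relation.Nullary using (yes; no)
open import Relation.Nullary.Decidable using (⌊_⌋)
open import Relation.Unary using (Pred; Decidable)
open import Level using (Level)
open import Algebra.Properties.AbelianGroup ℤP.+-0-abelianGroup using (∙-cancelʳ)
import Algebra.Properties.CommutativeMonoid.Sum ℕP.+-0-commutativeMonoid as FinSum

sumBelow-cong : ∀ {f g} n → (∀ j → f j ≡ g j) → sumBelow f n ≡ sumBelow g n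
sumBelow-cong zero    e = refl
sumBelow-cong (suc n) e = cong₂ _+_ (sumBelow-cong n e) (e n)

sumBelow-head : ∀ f n → sumBelow f (suc n) ≡ f 0 + sumBelow (f ∘ suc) n
sumBelow-head f zero    = ℤP.+-comm (+ 0) (f 0)
sumBelow-head f (suc n) =
  trans (cong (_+ f (suc n)) (sumBelow-head f n)) (ℤP.+-assoc (f 0) _ _)

sumBelow-sub : ∀ f g n → sumBelow (λ j → f j - g j) n ≡ sumBelow f n - sumBelow g n
sumBelow-sub f g zero    = refl
sumBelow-sub f g (suc n) =
  trans (cong (_+ (f n - g n)) (sumBelow-sub f g n))
        (regroup (sumBelow f n) (sumBelow g n) (f n) (g n))
  where
  regroup : ∀ s t x z → (s - t) + (x - z) ≡ (s + x) - (t + z)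
  regroup = solve-∀

sumBelow-zero : ∀ n → sumBelow (λ _ → + 0) n ≡ + 0
sumBelow-zero zero    = refl
sumBelow-zero (suc n) = trans (ℤP.+-identityʳ _) (sumBelow-zero n)

-- Coefficients of (1-t)·B(t) for B(t) = Σ b(k) t^k.
Δ : (ℕ → ℤ) → ℕ → ℤ
Δ b zero    = b zero
Δ b (suc k) = b (suc k) - b k

Δ^ : ℕ → (ℕ → ℤ) → ℕ → ℤ
Δ^ zero    b = b
Δ^ (suc m) b = Δ (Δ^ m b)

Δ-cong : ∀ {b c} → (∀ k → b k ≡ c k) → ∀ k → Δ b k ≡ Δ c k
Δ-cong e zero    = e zero
Δ-cong e (suc k) = cong₂ _-_ (e (suc k)) (e k)

Δ^-cong : ∀ m {b c} → (∀ k → b k ≡ c k) → ∀ k → Δ^ m b k ≡ Δ^ m c k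
Δ^-cong zero    e = e
Δ^-cong (suc m) e = Δ-cong (Δ^-cong m e)

term : ℕ → (ℕ → ℕ) → ℕ → ℕ → ℤ
term m a k j = sgn j * + (m C j) * + a (k ∸ j)

term-pascal : ∀ m a k j →
  term (suc m) a (suc k) (suc j) ≡ term m a (suc k) (suc j) - term m a k j
term-pascal m a k j = begin
    - sgn j * + (suc m C suc j) * x
  ≡⟨ cong (λ c → - sgn j * c * x)
          (trans (cong +_ (≡.sym (nCk+nC[k+1]≡[n+1]C[k+1] m j))) (ℤP.pos-+ (m C j) (m C suc j))) ⟩
    - sgn j * (+ (m C j) + + (m C suc j)) * x
  ≡⟨ split (sgn j) (+ (m C j)) (+ (m C suc j)) x ⟩
    - sgn j * + (m C suc j) * x - sgn j * + (m C j) * x ∎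
  where
  open ≡-Reasoning
  x = + a (k ∸ j)
  split : ∀ s c c′ x → - s * (c + c′) * x ≡ - s * c′ * x - s * c * x
  split = solve-∀

timesOneMinusTPow-suc : ∀ m a k →
  timesOneMinusTPow (suc m) a k ≡ Δ (timesOneMinusTPow m a) k
timesOneMinusTPow-suc m a zero    = refl
timesOneMinusTPow-suc m a (suc k) = begin
    timesOneMinusTPow (suc m) a (suc k)
  ≡⟨ sumBelow-head (term (suc m) a (suc k)) (suc k) ⟩
    t₀ + sumBelow (λ j → term (suc m) a (suc k) (suc j)) (suc k)
  ≡⟨ cong (λ s → t₀ + s) (sumBelow-cong (suc k) (term-pascal m a k)) ⟩
    t₀ + sumBelow (λ j → term m a (suc k) (suc j) - term m a k j) (suc k)
  ≡⟨ cong (λ s → t₀ + s) (sumBelow-sub (λ j → term m a (suc k) (suc j)) (term m a k) (suc k)) ⟩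
    t₀ + (rest - timesOneMinusTPow m a k)
  ≡⟨ ℤP.+-assoc t₀ rest _ ⟨
    (t₀ + rest) - timesOneMinusTPow m a k
  ≡⟨ cong (_- timesOneMinusTPow m a k) (sumBelow-head (term m a (suc k)) (suc k)) ⟨
    timesOneMinusTPow m a (suc k) - timesOneMinusTPow m a k ∎
  where
  open ≡-Reasoning
  t₀ = term m a (suc k) 0
  rest = sumBelow (λ j → term m a (suc k) (suc j)) (suc k)

timesOneMinusTPow-zero : ∀ a k → timesOneMinusTPow 0 a k ≡ + a k
timesOneMinusTPow-zero a k = begin
    timesOneMinusTPow 0 a k
  ≡⟨ sumBelow-head (term 0 a k) k ⟩
    + 1 * + a k + sumBelow (λ j → term 0 a k (suc j)) k
  ≡⟨ cong₂ _+_ (ℤP.*-identityˡ (+ a k)) (sumBelow-cong k vanishing) ⟩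
    + a k + sumBelow (λ _ → + 0) k
  ≡⟨ trans (cong (λ s → + a k + s) (sumBelow-zero k)) (ℤP.+-identityʳ (+ a k)) ⟩
    + a k ∎
  where
  open ≡-Reasoning
  vanishing : ∀ j → term 0 a k (suc j) ≡ + 0
  vanishing j = trans (cong (_* + a (k ∸ suc j)) (ℤP.*-zeroʳ (- sgn j))) (ℤP.*-zeroˡ (+ a (k ∸ suc j)))

timesOneMinusTPow≡Δ^ : ∀ m a k → timesOneMinusTPow m a k ≡ Δ^ m (+_ ∘ a) k
timesOneMinusTPow≡Δ^ zero    a k = timesOneMinusTPow-zero a k
timesOneMinusTPow≡Δ^ (suc m) a k =
  trans (timesOneMinusTPow-suc m a k) (Δ-cong (timesOneMinusTPow≡Δ^ m a) k)

-- Coefficients of t·B'(t).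
weighted : (ℕ → ℤ) → ℕ → ℤ
weighted b q = + q * b q

diffOpCoeff-cong : ∀ m {f g} → (∀ k → f k ≡ g k) → ∀ k → diffOpCoeff m f k ≡ diffOpCoeff m g k
diffOpCoeff-cong m e zero    = refl
diffOpCoeff-cong m e (suc k) = cong₂ (λ u v → + suc k * u + (+ m - + k) * v) (e (suc k)) (e k)

Δ-weighted : ∀ b k → Δ (weighted b) k ≡ diffOpCoeff 0 b k
Δ-weighted b zero    = ℤP.*-zeroˡ (b 0)
Δ-weighted b (suc k) = identity (+ suc k * b (suc k)) (+ k) (b k)
  where
  identity : ∀ x K z → x - K * z ≡ x + (+ 0 - K) * z
  identity = solve-∀

Δ-diffOp : ∀ m b k → Δ (diffOpCoeff m b) k ≡ diffOpCoeff (suc m) (Δ b) k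
Δ-diffOp m b zero          = refl
Δ-diffOp m b (suc zero)    = identity (+ m) (b 0) (b 1)
  where
  identity : ∀ M y₀ y₁ → (+ 1 * y₁ + (M - + 0) * y₀) - + 0
                         ≡ + 1 * (y₁ - y₀) + ((+ 1 + M) - + 0) * y₀
  identity = solve-∀
Δ-diffOp m b (suc (suc k)) = identity (+ m) (+ k) (b k) (b (suc k)) (b (suc (suc k)))
  where
  identity : ∀ M K y₀ y₁ y₂ →
    ((+ 1 + (+ 1 + K)) * y₂ + (M - (+ 1 + K)) * y₁) - ((+ 1 + K) * y₁ + (M - K) * y₀)
    ≡ (+ 1 + (+ 1 + K)) * (y₂ - y₁) + ((+ 1 + M) - (+ 1 + K)) * (y₁ - y₀)
  identity = solve-∀

Δ^-weighted : ∀ m b k → Δ^ (suc m) (weighted b) k ≡ diffOpCoeff m (Δ^ m b) k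
Δ^-weighted zero    b k = Δ-weighted b k
Δ^-weighted (suc m) b k =
  trans (Δ-cong (Δ^-weighted m b) k) (Δ-diffOp m (Δ^ m b) k)

-- D_m determines a sequence from its constant term, since the coefficient
-- k·f(k) + (m-k+1)·f(k-1) can be solved for f(k) when k ≠ 0.
diffOpCoeff-injective : ∀ m f g → f 0 ≡ g 0 →
  (∀ k → diffOpCoeff m f k ≡ diffOpCoeff m g k) → ∀ k → f k ≡ g k
diffOpCoeff-injective m f g f₀≡g₀ eq zero    = f₀≡g₀
diffOpCoeff-injective m f g f₀≡g₀ eq (suc k) =
  ℤP.*-cancelˡ-≡ (+ suc k) (f (suc k)) (g (suc k)) (∙-cancelʳ (c * g k) _ _ same-lower-term)
  where
  c : ℤ
  c = + m - + k
  fₖ≡gₖ : f k ≡ g k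
  fₖ≡gₖ = diffOpCoeff-injective m f g f₀≡g₀ eq k
  same-lower-term : + suc k * f (suc k) + c * g k ≡ + suc k * g (suc k) + c * g k
  same-lower-term = trans (cong (λ z → + suc k * f (suc k) + c * z) (≡.sym fₖ≡gₖ)) (eq (suc k))

count : ∀ n q → ((Fin n → Fin q) → Bool) → ℕ
count n q P = length (filter (λ col → P col ≡? true) (allMaps n q))

Extensional : ∀ {n q} → ((Fin n → Fin q) → Bool) → Set
Extensional P = ∀ f g → (∀ i → f i ≡ g i) → P f ≡ P g

module _ {A : Set} {p : Level} {P : Pred A p} (P? : Decidable P) where

  length-filter-concat : ∀ {B : Set} (F : B → List A) q (h : Fin q → B) →
    length (filter P? (concatMap F (tabulate h)))
      ≡ FinSum.sum (λ c → length (filter P? (F (h c))))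
  length-filter-concat F zero    h = refl
  length-filter-concat F (suc q) h =
    trans (cong length (filter-++ P? (F (h fzero)) _))
      (trans (length-++ (filter P? (F (h fzero))))
             (cong (length (filter P? (F (h fzero))) ℕ.+_) (length-filter-concat F q (h ∘ fsuc))))

length-filter-map : ∀ {A B : Set} (P : B → Bool) (g : A → B) xs →
  length (filter (λ x → P x ≡? true) (map g xs)) ≡ length (filter (λ x → P (g x) ≡? true) xs)
length-filter-map P g []       = refl
length-filter-map P g (x ∷ xs) with P (g x)
... | true  = cong suc (length-filter-map P g xs)
... | false = length-filter-map P g xs

count-cong : ∀ n q {P P′} → (∀ f → P f ≡ P′ f) → count n q P ≡ count n q P′
count-cong n q e =
  cong length (filter-≐ _ _ ((λ {f} → trans (≡.sym (e f))) , (λ {f} → trans (e f))) (allMaps n q))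

count-suc : ∀ n q P → count (suc n) q P ≡ FinSum.sum (λ c → count n q (λ f → P (c ∷ᶠ f)))
count-suc n q P =
  trans (length-filter-concat (λ col → P col ≡? true) (λ c → map (c ∷ᶠ_) (allMaps n q)) q (λ c → c))
        (FinSum.sum-cong-≗ (λ c → length-filter-map P (c ∷ᶠ_) (allMaps n q)))

FinSum-const : ∀ q x → FinSum.sum {q} (λ _ → x) ≡ q ℕ.* x
FinSum-const zero    x = refl
FinSum-const (suc q) x = cong (x ℕ.+_) (FinSum-const q x)

∷ᶠ-cong : ∀ {n q} (c : Fin q) {f g : Fin n → Fin q} → (∀ i → f i ≡ g i) →
  ∀ i → (c ∷ᶠ f) i ≡ (c ∷ᶠ g) i
∷ᶠ-cong c e fzero    = refl
∷ᶠ-cong c e (fsuc i) = e i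

∷ᶠ-rename : ∀ {n q} (σ : Fin q → Fin q) (c : Fin q) (f : Fin n → Fin q) →
  ∀ i → (σ c ∷ᶠ (σ ∘ f)) i ≡ (σ ∘ (c ∷ᶠ f)) i
∷ᶠ-rename σ c f fzero    = refl
∷ᶠ-rename σ c f (fsuc i) = refl

count-recolour : ∀ n q (π : Permutation′ q) (P : (Fin n → Fin q) → Bool) → Extensional P →
  count n q P ≡ count n q (λ f → P ((π ⟨$⟩ʳ_) ∘ f))
count-recolour zero    q π P ext = count-cong zero q (λ f → ext _ _ (λ ()))
count-recolour (suc n) q π P ext = begin
    count (suc n) q P
  ≡⟨ count-suc n q P ⟩
    FinSum.sum (λ c → count n q (λ f → P (c ∷ᶠ f)))
  ≡⟨ FinSum.sum-permute (λ c → count n q (λ f → P (c ∷ᶠ f))) π ⟩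
    FinSum.sum (λ c → count n q (λ f → P (σ c ∷ᶠ f)))
  ≡⟨ FinSum.sum-cong-≗ (λ c → count-recolour n q π _ (λ f g e → ext _ _ (∷ᶠ-cong (σ c) e))) ⟩
    FinSum.sum (λ c → count n q (λ f → P (σ c ∷ᶠ (σ ∘ f))))
  ≡⟨ FinSum.sum-cong-≗ (λ c → count-cong n q (λ f → ext _ _ (∷ᶠ-rename σ c f))) ⟩
    FinSum.sum (λ c → count n q (λ f → P (σ ∘ (c ∷ᶠ f))))
  ≡⟨ count-suc n q (λ f → P (σ ∘ f)) ⟨
    count (suc n) q (λ f → P (σ ∘ f)) ∎
  where
  open ≡-Reasoning
  σ = π ⟨$⟩ʳ_

isProper-sameColours : ∀ {ℓ q q′} (G : SimpleGraph ℓ) (col : Fin ℓ → Fin q) (col′ : Fin ℓ → Fin q′) →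
  (∀ i j → ⌊ col i ≟ col j ⌋ ≡ ⌊ col′ i ≟ col′ j ⌋) → isProper G col ≡ isProper G col′
isProper-sameColours {ℓ} G col col′ e =
  all-cong (λ i → all-cong (λ j → cong (λ b → not (adj G i j ∧ b)) (e i j)) (allFin ℓ)) (allFin ℓ)
  where
  all-cong : ∀ {A : Set} {f g : A → Bool} → (∀ x → f x ≡ g x) → ∀ xs → all f xs ≡ all g xs
  all-cong e []       = refl
  all-cong e (x ∷ xs) = cong₂ _∧_ (e x) (all-cong e xs)

isProper-extensional : ∀ {ℓ q} (G : SimpleGraph ℓ) → Extensional {ℓ} {q} (isProper G)
isProper-extensional G f g e =
  isProper-sameColours G f g (λ i j → cong₂ (λ u v → ⌊ u ≟ v ⌋) (e i) (e j))

isProper-recolour : ∀ {ℓ q} (G : SimpleGraph ℓ) (π : Permutation′ q) col →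
  isProper G ((π ⟨$⟩ʳ_) ∘ col) ≡ isProper G col
isProper-recolour G π col = isProper-sameColours G _ col (λ i j → same-colour (col i) (col j))
  where
  same-colour : ∀ a b → ⌊ (π ⟨$⟩ʳ a) ≟ (π ⟨$⟩ʳ b) ⌋ ≡ ⌊ a ≟ b ⌋
  same-colour a b with a ≟ b | (π ⟨$⟩ʳ a) ≟ (π ⟨$⟩ʳ b)
  ... | yes _   | yes _     = refl
  ... | no _    | no _      = refl
  ... | yes a≡b | no σa≢σb  = ⊥-elim (σa≢σb (cong (π ⟨$⟩ʳ_) a≡b))
  ... | no a≢b  | yes σa≡σb = ⊥-elim (a≢b (Injection.injective (↔⇒↣ π) σa≡σb))

properFrom : ∀ {ℓ} (G : SimpleGraph (suc ℓ)) q → Fin q → ℕ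
properFrom {ℓ} G q c = count ℓ q (λ f → isProper G (c ∷ᶠ f))

-- The transposition of 0 and c matches colourings starting with 0 with those starting with c.
properFrom-independent : ∀ {ℓ} (G : SimpleGraph (suc ℓ)) q (c : Fin (suc q)) →
  properFrom G (suc q) c ≡ properFrom G (suc q) fzero
properFrom-independent {ℓ} G q c = begin
    properFrom G (suc q) c
  ≡⟨ count-recolour ℓ (suc q) π _ (λ f g e → isProper-extensional G _ _ (∷ᶠ-cong c e)) ⟩
    count ℓ (suc q) (λ f → isProper G (c ∷ᶠ (σ ∘ f)))
  ≡⟨ count-cong ℓ (suc q) (λ f → isProper-extensional G _ _ (∷ᶠ-rename σ fzero f)) ⟩
    count ℓ (suc q) (λ f → isProper G (σ ∘ (fzero ∷ᶠ f)))
  ≡⟨ count-cong ℓ (suc q) (λ f → isProper-recolour G π (fzero ∷ᶠ f)) ⟩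
    properFrom G (suc q) fzero ∎
  where
  open ≡-Reasoning
  π = transpose fzero c
  σ = π ⟨$⟩ʳ_

chromatic≡q*chromaticOverQ : ∀ {ℓ} (G : SimpleGraph (suc ℓ)) q →
  chromatic G q ≡ q ℕ.* chromaticOverQ G q
chromatic≡q*chromaticOverQ G zero    = refl
chromatic≡q*chromaticOverQ {ℓ} G (suc q) = trans c≡q*N (cong (suc q ℕ.*_) (≡.sym c/q≡N))
  where
  N : ℕ
  N = properFrom G (suc q) fzero
  c≡q*N : chromatic G (suc q) ≡ suc q ℕ.* N
  c≡q*N = trans (count-suc ℓ (suc q) (isProper G))
                (trans (FinSum.sum-cong-≗ (properFrom-independent G q)) (FinSum-const (suc q) N))
  c/q≡N : chromatic G (suc q) / suc q ≡ N
  c/q≡N = trans (cong (_/ suc q) (trans c≡q*N (ℕP.*-comm (suc q) N))) (m*n/n≡m N (suc q))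

w≡diffOp-y : ∀ {ℓ} (G : SimpleGraph (suc ℓ)) k → w G k ≡ diffOpCoeff (suc ℓ) (y G) k
w≡diffOp-y {ℓ} G k = begin
    w G k
  ≡⟨ timesOneMinusTPow≡Δ^ (suc (suc ℓ)) (chromatic G) k ⟩
    Δ^ (suc (suc ℓ)) (+_ ∘ chromatic G) k
  ≡⟨ Δ^-cong (suc (suc ℓ)) (λ q → trans (cong +_ (chromatic≡q*chromaticOverQ G q))
                                         (ℤP.pos-* q (chromaticOverQ G q))) k ⟩
    Δ^ (suc (suc ℓ)) (weighted (+_ ∘ chromaticOverQ G)) k
  ≡⟨ Δ^-weighted (suc ℓ) (+_ ∘ chromaticOverQ G) k ⟩
    diffOpCoeff (suc ℓ) (Δ^ (suc ℓ) (+_ ∘ chromaticOverQ G)) k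
  ≡⟨ diffOpCoeff-cong (suc ℓ) (λ q → ≡.sym (timesOneMinusTPow≡Δ^ (suc ℓ) (chromaticOverQ G) q)) k ⟩
    diffOpCoeff (suc ℓ) (y G) k ∎
  where open ≡-Reasoning

proposition3p4 : (ℓ : ℕ) → ℓ ≥ 1 → (G : SimpleGraph ℓ) →
    ((k : ℕ) → w G k ≡ diffOpCoeff ℓ (y G) k)
  × ((F : Poly) → coeff F 0 ≡ + 0 →
      ((k : ℕ) → w G k ≡ diffOpCoeff ℓ (coeff F) k) →
      (k : ℕ) → coeff F k ≡ y G k)
proposition3p4 (suc ℓ) _ G = w≡diffOp-y G , uniqueness
  where
  -- Y_G has zero constant term, since the q = 0 coefficient c_G(q)/q is 0.
  uniqueness : (F : Poly) → coeff F 0 ≡ + 0 →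
      ((k : ℕ) → w G k ≡ diffOpCoeff (suc ℓ) (coeff F) k) →
      (k : ℕ) → coeff F k ≡ y G k
  uniqueness F F₀≡0 W≡DF = diffOpCoeff-injective (suc ℓ) (coeff F) (y G) F₀≡0
    (λ k → trans (≡.sym (W≡DF k)) (w≡diffOp-y G k))
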